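{- Let $F:2^N\to\mathbb{R}$ be quasi-submodular. Let $Q_+$ be the set output by the UQSFMin procedure started from $X_0=\emptyset$ and $S_+$ the set output by the UQSFMin procedure started from $X_0=N$. Then every local minimum $P$ of $F$ satisfies $Q_+\subseteq P\subseteq S_+$.
   Context: $N=\{1,\dots,n\}$. For $A\subseteq N$ and $i\in N$, write $F(i\mid A)=F(A\cup\{i\})-F(A)$. $F$ is quasi-submodular if for all $X,Y\subseteq N$ both (i) $F(X\cap Y)\ge F(X)\Rightarrow F(Y)\ge F(X\cup Y)$ and (ii) $F(X\cap Y)>F(X)\Rightarrow F(Y)>F(X\cup Y)$ hold. A set $X\subseteq N$ is a local minimum of $F$ if $F(X\setminus\{i\})\ge F(X)$ for all $i\in X$ and $F(X\cup\{j\})\ge F(X)$ for all $j\in N\setminus X$. The UQSFMin procedure, started from $X_0\subseteq N$, runs for $t=0,1,2,\dots$: set $U_t=\{u\in N\setminus X_t: F(u\mid X_t)<0\}$ and $Y_t=X_t\cup U_t$; set $D_t=\{d\in X_t: F(d\mid Y_t\setminus\{d\})>0\}$ and $X_{t+1}=Y_t\setminus D_t$; if $X_{t+1}=X_t$, stop and output $X_t$; otherwise continue with $t+1$. -}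

module Defs where

open import Level using (Level)
open import Data.Nat using (ℕ; zero; suc)
open import Data.Bool using (Bool; not; _∧_)
open import Data.Sum using (_⊎_)
open import Data.Vec using (tabulate)
open import Data.Fin using (Fin)
open import Data.Fin.Subset using (Subset; _∈_; _∉_; _∪_; _∩_; ∁; ⁅_⁆)
open import Data.Fin.Subset.Properties using (_∈?_)
open import Relation.Nullary.Decidable using (⌊_⌋)
open import Relation.Binary.Bundles using (StrictTotalOrder)

-- F takes values in an arbitrary strict total order (ℝ with < is an instance).
module UQS {c ℓ₁ ℓ₂ : Level} (S : StrictTotalOrder c ℓ₁ ℓ₂) where
  open StrictTotalOrder S

  _≤_ : Carrier → Carrier → Set _
  x ≤ y = x < y ⊎ x ≈ y

  _∖_ : ∀ {n} → Subset n → Fin n → Subset n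
  X ∖ i = X ∩ ∁ ⁅ i ⁆

  module _ {n : ℕ} (F : Subset n → Carrier) where

    QuasiSubmodular : Set _
    QuasiSubmodular = ∀ (X Y : Subset n) →
      (F X ≤ F (X ∩ Y) → F (X ∪ Y) ≤ F Y) ×' (F X < F (X ∩ Y) → F (X ∪ Y) < F Y)
      where
        open import Data.Product renaming (_×_ to _×'_)

    LocalMin : Subset n → Set _
    LocalMin X = (∀ i → i ∈ X → F X ≤ F (X ∖ i))
               ×' (∀ j → j ∉ X → F X ≤ F (X ∪ ⁅ j ⁆))
      where
        open import Data.Product renaming (_×_ to _×'_)

    U : Subset n → Subset n
    U X = tabulate λ u → not ⌊ u ∈? X ⌋ ∧ ⌊ F (X ∪ ⁅ u ⁆) <? F X ⌋

    D : Subset n → Subset n → Subset n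
    D X Y = tabulate λ d → ⌊ d ∈? X ⌋ ∧ ⌊ F (Y ∖ d) <? F Y ⌋

    step : Subset n → Subset n
    step X = Y ∩ ∁ (D X Y)
      where Y = X ∪ U X

    iter : ℕ → Subset n → Subset n
    iter zero X₀ = X₀
    iter (suc t) X₀ = step (iter t X₀)

open UQS public

-- For a local minimum P, both "X ⊆ P" and "P ⊆ X" are invariant under a round of
-- UQSFMin. Quasi-submodularity propagates "adding i strictly decreases F" and
-- "removing i does not decrease F" from a set to its supersets. If X ⊆ P and some
-- i ∉ P entered, adding i would therefore decrease F at P, against local
-- minimality; if P ⊆ X, no i ∈ P is deleted, since removing i from P does not
-- decrease F, hence neither does removing it from X ∪ U X. So the runs from ∅ and
-- from N stay below resp. above P at every round, fixed point or not.
module Submission where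

open import Defs hiding (_≤_; _∖_)
open import Data.Bool using (Bool; T)
open import Data.Bool.Properties using (T-≡; T-∧)
open import Data.Empty using (⊥-elim)
open import Data.Fin using (Fin; _≟_)
open import Data.Fin.Subset using (Subset; _⊆_; _∈_; _∉_; _∪_; _∩_; ∁; ⁅_⁆; ⊥; ⊤)
open import Data.Fin.Subset.Properties
  using ( _∈?_; ⊆-antisym; ⊆-min; ⊆-max; x∈⁅y⁆⇒x≡y; x≢y⇒x∉⁅y⁆
        ; x∈p∩q⁺; x∈p∩q⁻; x∈p∪q⁺; x∈p∪q⁻; x∉p⇒x∈∁p )
open import Data.Nat using (ℕ; zero; suc)
open import Data.Product using (_×_; _,_; proj₁; proj₂)
open import Data.Sum using (inj₁; inj₂)
open import Data.Vec using (tabulate)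
open import Data.Vec.Properties using (lookup∘tabulate; []=⇒lookup)
open import Function using (Equivalence)
open import Relation.Binary.Bundles using (StrictTotalOrder)
open import Relation.Binary.PropositionalEquality using (_≡_; refl; subst; sym; trans)
open import Relation.Nullary using (¬_; yes; no; contradiction)
open import Relation.Nullary.Decidable using (⌊_⌋; toWitness)

module _ {n : ℕ} where

  x∈tabulate⇒T : {f : Fin n → Bool} {x : Fin n} → x ∈ tabulate f → T (f x)
  x∈tabulate⇒T {f} {x} x∈ =
    Equivalence.from T-≡ (trans (sym (lookup∘tabulate f x)) ([]=⇒lookup x∈))

  ∪⁅x⁆∩≡ : {p q : Subset n} {x : Fin n} → p ⊆ q → x ∉ q → (p ∪ ⁅ x ⁆) ∩ q ≡ p
  ∪⁅x⁆∩≡ {p} {q} {x} p⊆q x∉q = ⊆-antisym ⊆p (λ y∈p → x∈p∩q⁺ (x∈p∪q⁺ (inj₁ y∈p) , p⊆q y∈p))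
    where
    ⊆p : (p ∪ ⁅ x ⁆) ∩ q ⊆ p
    ⊆p y∈ with x∈p∩q⁻ (p ∪ ⁅ x ⁆) q y∈
    ... | y∈p∪x , y∈q with x∈p∪q⁻ p ⁅ x ⁆ y∈p∪x
    ...   | inj₁ y∈p = y∈p
    ...   | inj₂ y∈x = contradiction (subst (_∈ q) (x∈⁅y⁆⇒x≡y x y∈x) y∈q) x∉q

  ∪⁅x⁆∪≡ : {p q : Subset n} {x : Fin n} → p ⊆ q → (p ∪ ⁅ x ⁆) ∪ q ≡ q ∪ ⁅ x ⁆
  ∪⁅x⁆∪≡ {p} {q} {x} p⊆q = ⊆-antisym ⊆q∪x q∪x⊆
    where
    ⊆q∪x : (p ∪ ⁅ x ⁆) ∪ q ⊆ q ∪ ⁅ x ⁆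
    ⊆q∪x y∈ with x∈p∪q⁻ (p ∪ ⁅ x ⁆) q y∈
    ... | inj₂ y∈q = x∈p∪q⁺ (inj₁ y∈q)
    ... | inj₁ y∈p∪x with x∈p∪q⁻ p ⁅ x ⁆ y∈p∪x
    ...   | inj₁ y∈p = x∈p∪q⁺ (inj₁ (p⊆q y∈p))
    ...   | inj₂ y∈x = x∈p∪q⁺ (inj₂ y∈x)
    q∪x⊆ : q ∪ ⁅ x ⁆ ⊆ (p ∪ ⁅ x ⁆) ∪ q
    q∪x⊆ y∈ with x∈p∪q⁻ q ⁅ x ⁆ y∈
    ... | inj₁ y∈q = x∈p∪q⁺ (inj₂ y∈q)
    ... | inj₂ y∈x = x∈p∪q⁺ (inj₁ (x∈p∪q⁺ (inj₂ y∈x)))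

  ∩∖≡ : {p q : Subset n} {x : Fin n} → p ⊆ q → p ∩ (q ∩ ∁ ⁅ x ⁆) ≡ p ∩ ∁ ⁅ x ⁆
  ∩∖≡ {p} {q} {x} p⊆q = ⊆-antisym ⊆p∖x p∖x⊆
    where
    ⊆p∖x : p ∩ (q ∩ ∁ ⁅ x ⁆) ⊆ p ∩ ∁ ⁅ x ⁆
    ⊆p∖x y∈ with x∈p∩q⁻ p _ y∈
    ... | y∈p , y∈q∖x = x∈p∩q⁺ (y∈p , proj₂ (x∈p∩q⁻ q _ y∈q∖x))
    p∖x⊆ : p ∩ ∁ ⁅ x ⁆ ⊆ p ∩ (q ∩ ∁ ⁅ x ⁆)
    p∖x⊆ y∈ with x∈p∩q⁻ p _ y∈
    ... | y∈p , y∉x = x∈p∩q⁺ (y∈p , x∈p∩q⁺ (p⊆q y∈p , y∉x))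

  ∪∖≡ : {p q : Subset n} {x : Fin n} → p ⊆ q → x ∈ p → p ∪ (q ∩ ∁ ⁅ x ⁆) ≡ q
  ∪∖≡ {p} {q} {x} p⊆q x∈p = ⊆-antisym ⊆q q⊆
    where
    ⊆q : p ∪ (q ∩ ∁ ⁅ x ⁆) ⊆ q
    ⊆q y∈ with x∈p∪q⁻ p _ y∈
    ... | inj₁ y∈p = p⊆q y∈p
    ... | inj₂ y∈q∖x = proj₁ (x∈p∩q⁻ q _ y∈q∖x)
    q⊆ : q ⊆ p ∪ (q ∩ ∁ ⁅ x ⁆)
    q⊆ {y} y∈q with y ≟ x
    ... | yes refl = x∈p∪q⁺ (inj₁ x∈p)
    ... | no y≢x = x∈p∪q⁺ (inj₂ (x∈p∩q⁺ (y∈q , x∉p⇒x∈∁p (x≢y⇒x∉⁅y⁆ y≢x))))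

module _ {c ℓ₁ ℓ₂} (S : StrictTotalOrder c ℓ₁ ℓ₂) {n : ℕ}
         (F : Subset n → StrictTotalOrder.Carrier S) where

  open StrictTotalOrder S using (_<_; _<?_; asym; irrefl; module Eq)
  open UQS S using (_≤_; _∖_)

  ≤⇒≯ : ∀ {x y} → x ≤ y → ¬ (y < x)
  ≤⇒≯ (inj₁ x<y) y<x = asym x<y y<x
  ≤⇒≯ (inj₂ x≈y) y<x = irrefl (Eq.sym x≈y) y<x

  ∈U⇒F[X∪u]<F[X] : ∀ {X u} → u ∈ U S F X → F (X ∪ ⁅ u ⁆) < F X
  ∈U⇒F[X∪u]<F[X] {X} {u} u∈U =
    toWitness (proj₂ (Equivalence.to (T-∧ {y = ⌊ F (X ∪ ⁅ u ⁆) <? F X ⌋})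
                                      (x∈tabulate⇒T u∈U)))

  ∈D⇒F[Y∖d]<F[Y] : ∀ {X Y d} → d ∈ D S F X Y → F (Y ∖ d) < F Y
  ∈D⇒F[Y∖d]<F[Y] {X} {Y} {d} d∈D =
    toWitness (proj₂ (Equivalence.to (T-∧ {⌊ d ∈? X ⌋} {⌊ F (Y ∖ d) <? F Y ⌋})
                                      (x∈tabulate⇒T d∈D)))

  module _ (quasiSubmodular : QuasiSubmodular S F) where

    F[A∪i]<F[A]⇒F[B∪i]<F[B] : ∀ {A B i} → A ⊆ B → i ∉ B →
                              F (A ∪ ⁅ i ⁆) < F A → F (B ∪ ⁅ i ⁆) < F B
    F[A∪i]<F[A]⇒F[B∪i]<F[B] {A} {B} {i} A⊆B i∉B lt =
      subst (λ Z → F Z < F B) (∪⁅x⁆∪≡ A⊆B)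
        (proj₂ (quasiSubmodular (A ∪ ⁅ i ⁆) B)
          (subst (λ Z → F (A ∪ ⁅ i ⁆) < F Z) (sym (∪⁅x⁆∩≡ A⊆B i∉B)) lt))

    F[A]≤F[A∖i]⇒F[B]≤F[B∖i] : ∀ {A B i} → A ⊆ B → i ∈ A →
                              F A ≤ F (A ∖ i) → F B ≤ F (B ∖ i)
    F[A]≤F[A∖i]⇒F[B]≤F[B∖i] {A} {B} {i} A⊆B i∈A le =
      subst (λ Z → F Z ≤ F (B ∖ i)) (∪∖≡ A⊆B i∈A)
        (proj₁ (quasiSubmodular A (B ∖ i))
          (subst (λ Z → F A ≤ F Z) (sym (∩∖≡ A⊆B)) le))

    module _ {P : Subset n} (localMin : LocalMin S F P) where

      step-preserves-⊆ : ∀ {X} → X ⊆ P → step S F X ⊆ P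
      step-preserves-⊆ {X} X⊆P {i} i∈step
        with x∈p∪q⁻ X (U S F X) (proj₁ (x∈p∩q⁻ _ _ i∈step))
      ... | inj₁ i∈X = X⊆P i∈X
      ... | inj₂ i∈U with i ∈? P
      ...   | yes i∈P = i∈P
      ...   | no i∉P = ⊥-elim (≤⇒≯ (proj₂ localMin i i∉P)
                         (F[A∪i]<F[A]⇒F[B∪i]<F[B] X⊆P i∉P (∈U⇒F[X∪u]<F[X] i∈U)))

      step-preserves-⊇ : ∀ {X} → P ⊆ X → P ⊆ step S F X
      step-preserves-⊇ {X} P⊆X {i} i∈P = x∈p∩q⁺ (i∈Y , x∉p⇒x∈∁p i∉D)
        where
        Y = X ∪ U S F X
        P⊆Y : P ⊆ Y
        P⊆Y j∈P = x∈p∪q⁺ (inj₁ (P⊆X j∈P))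
        i∈Y : i ∈ Y
        i∈Y = P⊆Y i∈P
        i∉D : i ∉ D S F X Y
        i∉D i∈D = ≤⇒≯ (F[A]≤F[A∖i]⇒F[B]≤F[B∖i] P⊆Y i∈P (proj₁ localMin i i∈P))
                      (∈D⇒F[Y∖d]<F[Y] i∈D)

      iter-⊥-⊆ : ∀ t → iter S F t ⊥ ⊆ P
      iter-⊥-⊆ zero = ⊆-min P
      iter-⊥-⊆ (suc t) = step-preserves-⊆ (iter-⊥-⊆ t)

      iter-⊤-⊇ : ∀ t → P ⊆ iter S F t ⊤
      iter-⊤-⊇ zero = ⊆-max P
      iter-⊤-⊇ (suc t) = step-preserves-⊇ (iter-⊤-⊇ t)

lemma3 : ∀ {c ℓ₁ ℓ₂} (S : StrictTotalOrder c ℓ₁ ℓ₂) (n : ℕ)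
    (F : Subset n → StrictTotalOrder.Carrier S) →
    QuasiSubmodular S F →
    ∀ (P : Subset n) → LocalMin S F P →
    (∀ (t : ℕ) → step S F (iter S F t ⊥) ≡ iter S F t ⊥ → iter S F t ⊥ ⊆ P)
    × (∀ (t : ℕ) → step S F (iter S F t ⊤) ≡ iter S F t ⊤ → P ⊆ iter S F t ⊤)
lemma3 S n F qs P lm =
  (λ t _ → iter-⊥-⊆ S F qs lm t) , (λ t _ → iter-⊤-⊇ S F qs lm t)
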